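{- Let $q$ be a prime power, $E=\mathbb{F}_q^n$, and $1<k_1<k_2<n$. Let $\mathcal{M}_1=\mathcal{U}_{k_1,n}(q)$ and $\mathcal{M}_2=\mathcal{U}_{k_2,n}(q)$. Let $a,\mu$ be integers with $a\ge1$, $\mu\ge2$, let $\lambda=\frac{a}{\mu}$ with $0<\lambda<1$, and let $\mathcal{M}=(1-\lambda)\mathcal{M}_1+\lambda\mathcal{M}_2$. If $\mu\ge\lceil n/k_1\rceil$, then every subspace of $E$ is $\mu$-independent in $\mathcal{M}$, i.e. $\mathcal{I}_\mu(\mathcal{M})=\mathcal{L}(E)$.
   Context: $\mathcal{L}(E)$ is the lattice of subspaces of $E$. The uniform $q$-matroid $\mathcal{U}_{k,n}(q)$ has rank function $\rho(V)=\min\{k,\dim V\}$ on $\mathcal{L}(E)$. For $q$-polymatroids with rank functions $\rho_1,\rho_2$, $(1-\lambda)\mathcal{M}_1+\lambda\mathcal{M}_2$ is the $q$-polymatroid with rank function $(1-\lambda)\rho_1+\lambda\rho_2$. A positive rational $\mu$ with $\mu\rho(X)\in\mathbb{Z}_{\ge0}$ for all $X$ is a denominator (here $\mu$ is one). A space $I$ is $\mu$-independent if $\rho(J)\ge\dim(J)/\mu$ for all $J\le I$; $\mathcal{I}_\mu(\mathcal{M})$ is the set of $\mu$-independent spaces. -}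

module Defs where

open import Level using (Level; _⊔_) renaming (suc to lsuc)
open import Algebra.Bundles using (CommutativeRing)
open import Data.Nat as ℕ using (ℕ; zero; suc; _∸_; NonZero)
open import Data.Nat.DivMod using (_/_)
open import Data.Nat.Primality using (Prime)
open import Data.Fin using (Fin; zero; suc)
open import Data.Integer using (+_)
open import Data.Rational as ℚ using (ℚ)
open import Data.Product using (Σ; ∃; _×_; _,_)
open import Relation.Binary.PropositionalEquality using (_≡_)
open import Relation.Nullary using (¬_)

record Field (c ℓ : Level) : Set (lsuc (c ⊔ ℓ)) where
  field
    commutativeRing : CommutativeRing c ℓ
  open CommutativeRing commutativeRing public
  field
    0≉1     : ¬ (0# ≈ 1#)
    inverse : ∀ x → ¬ (x ≈ 0#) → Σ Carrier λ y → (x * y) ≈ 1#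

IsPrimePower : ℕ → Set
IsPrimePower q = Σ ℕ λ p → Σ ℕ λ e → Prime p × (1 ℕ.≤ e) × (q ≡ p ℕ.^ e)

HasCard : ∀ {c ℓ} → Field c ℓ → ℕ → Set (c ⊔ ℓ)
HasCard F q =
  Σ (Fin q → Carrier) λ enum →
    (∀ i j → enum i ≈ enum j → i ≡ j) × (∀ x → Σ (Fin q) λ i → enum i ≈ x)
  where open Field F

IsFiniteField : ∀ {c ℓ} → Field c ℓ → ℕ → Set (c ⊔ ℓ)
IsFiniteField F q = IsPrimePower q × HasCard F q

module LinearAlgebra {c ℓ} (F : Field c ℓ) (n : ℕ) where
  open Field F using (Carrier; _≈_; 0#; _+_; _*_)

  Vec : Set c
  Vec = Fin n → Carrier

  _≈ᵥ_ : Vec → Vec → Set ℓ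
  u ≈ᵥ v = ∀ i → u i ≈ v i

  0ᵥ : Vec
  0ᵥ _ = 0#

  _+ᵥ_ : Vec → Vec → Vec
  (u +ᵥ v) i = u i + v i

  _·_ : Carrier → Vec → Vec
  (a · v) i = a * v i

  lincomb : ∀ {d} → (Fin d → Carrier) → (Fin d → Vec) → Vec
  lincomb {zero}  α b = 0ᵥ
  lincomb {suc d} α b = (α zero · b zero) +ᵥ lincomb (λ i → α (suc i)) (λ i → b (suc i))

  record Subspace : Set (lsuc (c ⊔ ℓ)) where
    field
      _∈V     : Vec → Set (c ⊔ ℓ)
      resp    : ∀ {u v} → u ≈ᵥ v → u ∈V → v ∈V
      zero∈   : 0ᵥ ∈V
      +-closed : ∀ {u v} → u ∈V → v ∈V → (u +ᵥ v) ∈V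
      ·-closed : ∀ a {v} → v ∈V → (a · v) ∈V
  open Subspace public

  _≤ₛ_ : Subspace → Subspace → Set (c ⊔ ℓ)
  J ≤ₛ I = ∀ v → _∈V J v → _∈V I v

  HasDim : Subspace → ℕ → Set (c ⊔ ℓ)
  HasDim V d =
    Σ (Fin d → Vec) λ b →
      (∀ i → _∈V V (b i))
      × (∀ α → lincomb α b ≈ᵥ 0ᵥ → ∀ i → α i ≈ 0#)
      × (∀ v → _∈V V v → Σ (Fin d → Carrier) λ α → v ≈ᵥ lincomb α b)

  -- A (ℚ-valued) rank function on L(E). Since dim is given as a relation,
  -- a rank function receives the subspace together with its dimension.
  RankFn : Set (lsuc (c ⊔ ℓ))
  RankFn = (V : Subspace) (d : ℕ) → HasDim V d → ℚ

  uniform : ℕ → RankFn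
  uniform k V d _ = (+ (k ℕ.⊓ d)) ℚ./ 1

  combine : ℚ → RankFn → RankFn → RankFn
  combine λ' ρ₁ ρ₂ V d h = ((ℚ.1ℚ ℚ.- λ') ℚ.* ρ₁ V d h) ℚ.+ (λ' ℚ.* ρ₂ V d h)

  IsIndep : (μ : ℕ) .{{_ : NonZero μ}} → RankFn → Subspace → Set (lsuc (c ⊔ ℓ))
  IsIndep μ ρ I = ∀ (J : Subspace) → J ≤ₛ I → ∀ d (h : HasDim J d) →
    ((+ d) ℚ./ μ) ℚ.≤ ρ J d h

⌈_/_⌉ : ℕ → (k : ℕ) → .{{_ : NonZero k}} → ℕ
⌈ m / k ⌉ = (m ℕ.+ (k ∸ 1)) / k

{-# OPTIONS --safe #-}
module Submission where

open import Defs
open import Level using (Level; _⊔_)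
open import Data.Nat as ℕ using (ℕ; NonZero)
open import Data.Integer using (+_)
open import Data.Rational as ℚ using (ℚ)

open import Data.Nat using (zero; suc; _⊓_; _^_; s≤s; z≤n)
import Data.Nat.Properties as ℕP
open import Data.Nat.DivMod using (_%_; m≡m%n+[m/n]*n; m%n<n)
open import Data.Fin as Fin using (Fin; zero; suc; funToFin; finToFun)
open import Data.Fin.Properties using (funToFin-finToFin; finToFun-funToFin; injective⇒≤)
open import Data.Product using (_,_; proj₁; proj₂)
open import Data.Empty using (⊥-elim)
open import Function using (_∘_)
open import Relation.Binary.PropositionalEquality as ≡ using (_≡_; _≗_; refl; cong; cong₂)
import Data.Integer as ℤ
import Data.Integer.Properties as ℤP
import Data.Rational.Properties as ℚP
import Data.Rational.Unnormalised as ℚᵘ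
import Data.Rational.Unnormalised.Properties as ℚᵘP
import Algebra.Properties.Ring as RingProperties
import Algebra.Properties.Group as GroupProperties
import Algebra.Properties.AbelianGroup as AbelianGroupProperties
import Algebra.Properties.CommutativeSemigroup as CommutativeSemigroupProperties
open import Algebra.Bundles using (AbelianGroup)
import Relation.Binary.Reasoning.Setoid as SetoidReasoning

-- Over F_q a linearly independent family of d vectors in F_q^n yields q^d
-- distinct vectors, so d ≤ n; with μ ≥ ⌈n/k₁⌉ this gives d ≤ k₁ μ, i.e.
-- d/μ ≤ min(k₁, d).  Finally min(k₁, d) ≤ min(k₂, d), so the convex
-- combination of the two uniform ranks is at least min(k₁, d).

-- _/_ normalises by the gcd; the comparison goes through ℚᵘ, whose ≤ is cross-multiplication.
x*v≤u*y⇒x/y≤u/v : ∀ x y u v .{{_ : NonZero y}} .{{_ : NonZero v}} →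
  x ℕ.* v ℕ.≤ u ℕ.* y → (+ x) ℚ./ y ℚ.≤ (+ u) ℚ./ v
x*v≤u*y⇒x/y≤u/v x (suc y) u (suc v) xv≤uy = ℚP.toℚᵘ-cancel-≤
  (ℚᵘP.≤-respˡ-≃ (ℚᵘP.≃-sym (ℚP.toℚᵘ-fromℚᵘ (ℚᵘ.mkℚᵘ (+ x) y)))
    (ℚᵘP.≤-respʳ-≃ (ℚᵘP.≃-sym (ℚP.toℚᵘ-fromℚᵘ (ℚᵘ.mkℚᵘ (+ u) v)))
      (ℚᵘ.*≤* (≡.subst₂ ℤ._≤_ (ℤP.pos-* x (suc v)) (ℤP.pos-* u (suc y)) (ℤ.+≤+ xv≤uy)))))

[1-λ]p+λp≡p : ∀ λ' p → (ℚ.1ℚ ℚ.- λ') ℚ.* p ℚ.+ λ' ℚ.* p ≡ p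
[1-λ]p+λp≡p λ' p = begin
  (ℚ.1ℚ ℚ.- λ') ℚ.* p ℚ.+ λ' ℚ.* p  ≡⟨ ℚP.*-distribʳ-+ p (ℚ.1ℚ ℚ.- λ') λ' ⟨
  (ℚ.1ℚ ℚ.- λ' ℚ.+ λ') ℚ.* p        ≡⟨ cong (ℚ._* p) (ℚP.+-assoc ℚ.1ℚ (ℚ.- λ') λ') ⟩
  (ℚ.1ℚ ℚ.+ (ℚ.- λ' ℚ.+ λ')) ℚ.* p  ≡⟨ cong (λ r → (ℚ.1ℚ ℚ.+ r) ℚ.* p) (ℚP.+-inverseˡ λ') ⟩
  (ℚ.1ℚ ℚ.+ ℚ.0ℚ) ℚ.* p             ≡⟨ ℚP.*-identityˡ p ⟩
  p                                  ∎
  where open ≡.≡-Reasoning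

p≤q⇒p≤[1-λ]p+λq : ∀ λ' .{{_ : ℚ.NonNegative λ'}} {p q} → p ℚ.≤ q →
  p ℚ.≤ (ℚ.1ℚ ℚ.- λ') ℚ.* p ℚ.+ λ' ℚ.* q
p≤q⇒p≤[1-λ]p+λq λ' {p} {q} p≤q = begin
  p                                  ≡⟨ [1-λ]p+λp≡p λ' p ⟨
  (ℚ.1ℚ ℚ.- λ') ℚ.* p ℚ.+ λ' ℚ.* p  ≤⟨ ℚP.+-monoʳ-≤ ((ℚ.1ℚ ℚ.- λ') ℚ.* p) (ℚP.*-monoˡ-≤-nonNeg λ' p≤q) ⟩
  (ℚ.1ℚ ℚ.- λ') ℚ.* p ℚ.+ λ' ℚ.* q  ∎
  where open ℚP.≤-Reasoning

n≤⌈n/k⌉*k : ∀ n k .{{_ : NonZero k}} → n ℕ.≤ ⌈ n / k ⌉ ℕ.* k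
n≤⌈n/k⌉*k n (suc k) = ℕP.+-cancelʳ-≤ k n (⌈ n / suc k ⌉ ℕ.* suc k) (begin
  n ℕ.+ k                          ≡⟨ m≡m%n+[m/n]*n (n ℕ.+ k) (suc k) ⟩
  (n ℕ.+ k) % suc k ℕ.+ Q          ≤⟨ ℕP.+-monoˡ-≤ Q (ℕP.≤-pred (m%n<n (n ℕ.+ k) (suc k))) ⟩
  k ℕ.+ Q                          ≡⟨ ℕP.+-comm k Q ⟩
  Q ℕ.+ k                          ∎)
  where
  open ℕP.≤-Reasoning
  Q = ⌈ n / suc k ⌉ ℕ.* suc k

funToFin-cong : ∀ {m k} {f g : Fin m → Fin k} → f ≗ g → funToFin f ≡ funToFin g
funToFin-cong {zero}  f≗g = refl
funToFin-cong {suc m} f≗g = cong₂ Fin.combine (f≗g zero) (funToFin-cong (f≗g ∘ suc))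

funToFin-injective : ∀ {m k} (f g : Fin m → Fin k) → funToFin f ≡ funToFin g → f ≗ g
funToFin-injective f g eq i = begin
  f i                        ≡⟨ finToFun-funToFin f i ⟨
  finToFun (funToFin f) i    ≡⟨ cong (λ x → finToFun x i) eq ⟩
  finToFun (funToFin g) i    ≡⟨ finToFun-funToFin g i ⟩
  g i                        ∎
  where open ≡.≡-Reasoning

-- Functions are compared pointwise, as there is no function extensionality.
≗-injective⇒^≤ : ∀ {q d n} (f : (Fin d → Fin q) → (Fin n → Fin q)) →
  (∀ u v → f u ≗ f v → u ≗ v) → q ^ d ℕ.≤ q ^ n
≗-injective⇒^≤ {q} {d} f f-inj = injective⇒≤ {f = funToFin ∘ f ∘ finToFun} inj
  where
  inj : ∀ {i j : Fin (q ^ d)} → funToFin (f (finToFun i)) ≡ funToFin (f (finToFun j)) → i ≡ j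
  inj {i} {j} eq = begin
    i                               ≡⟨ funToFin-finToFin {d} {q} i ⟨
    funToFin (finToFun {q} {d} i)   ≡⟨ funToFin-cong (f-inj _ _ (funToFin-injective _ _ eq)) ⟩
    funToFin (finToFun {q} {d} j)   ≡⟨ funToFin-finToFin {d} {q} j ⟩
    j                               ∎
    where open ≡.≡-Reasoning

module _ {c ℓ} (F : Field c ℓ) where
  open Field F hiding (zero)

  HasCard⇒1<q : ∀ {q} → HasCard F q → 1 ℕ.< q
  HasCard⇒1<q {zero} (_ , _ , surj) with surj 0#
  ... | () , _
  HasCard⇒1<q {suc zero} (_ , _ , surj) with surj 0# | surj 1#
  ... | zero , e≈0 | zero , e≈1 = ⊥-elim (0≉1 (trans (sym e≈0) e≈1))
  HasCard⇒1<q {suc (suc q)} _ = s≤s (s≤s z≤n)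

module _ {c ℓ} (F : Field c ℓ) (n : ℕ) where
  open Field F hiding (zero)
  open LinearAlgebra F n
  open RingProperties ring using ([y-z]x≈yx-zx)
  open GroupProperties (AbelianGroup.group +-abelianGroup) using (x∙y⁻¹≈ε⇒x≈y; x≈y⇒x∙y⁻¹≈ε; ε⁻¹≈ε)
  open AbelianGroupProperties +-abelianGroup using (⁻¹-∙-comm)
  open CommutativeSemigroupProperties +-commutativeSemigroup using (interchange)

  Independent : ∀ {d} → (Fin d → Vec) → Set (c ⊔ ℓ)
  Independent b = ∀ α → lincomb α b ≈ᵥ 0ᵥ → ∀ i → α i ≈ 0#

  [a-b]x+[A-B]≈[ax+A]-[bx+B] : ∀ a b x A B → (a - b) * x + (A - B) ≈ (a * x + A) - (b * x + B)
  [a-b]x+[A-B]≈[ax+A]-[bx+B] a b x A B = begin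
    (a - b) * x + (A - B)            ≈⟨ +-congʳ ([y-z]x≈yx-zx x a b) ⟩
    (a * x - b * x) + (A - B)        ≈⟨ interchange (a * x) (- (b * x)) A (- B) ⟩
    (a * x + A) + (- (b * x) - B)    ≈⟨ +-congˡ (⁻¹-∙-comm (b * x) B) ⟩
    (a * x + A) - (b * x + B)        ∎
    where open SetoidReasoning setoid

  lincomb-sub : ∀ {d} (α β : Fin d → Carrier) (b : Fin d → Vec) i →
    lincomb (λ j → α j - β j) b i ≈ lincomb α b i - lincomb β b i
  lincomb-sub {zero}  α β b i = sym (trans (+-congˡ ε⁻¹≈ε) (+-identityʳ 0#))
  lincomb-sub {suc d} α β b i =
    trans (+-congˡ (lincomb-sub (α ∘ suc) (β ∘ suc) (b ∘ suc) i))
          ([a-b]x+[A-B]≈[ax+A]-[bx+B] (α zero) (β zero) (b zero i) _ _)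

  lincomb-injective : ∀ {d} {b : Fin d → Vec} → Independent b →
    ∀ α β → lincomb α b ≈ᵥ lincomb β b → ∀ j → α j ≈ β j
  lincomb-injective {b = b} ind α β eq j = x∙y⁻¹≈ε⇒x≈y (α j) (β j)
    (ind (λ j → α j - β j) (λ i → trans (lincomb-sub α β b i) (x≈y⇒x∙y⁻¹≈ε (eq i))) j)

  module _ {q : ℕ} (card : HasCard F q) where
    private
      enum : Fin q → Carrier
      enum = proj₁ card

      enum-injective : ∀ i j → enum i ≈ enum j → i ≡ j
      enum-injective = proj₁ (proj₂ card)

      index : Carrier → Fin q
      index x = proj₁ (proj₂ (proj₂ card) x)

      enum-index : ∀ x → enum (index x) ≈ x
      enum-index x = proj₂ (proj₂ (proj₂ card) x)

    coordinates : ∀ {d} → (Fin d → Vec) → (Fin d → Fin q) → (Fin n → Fin q)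
    coordinates b u i = index (lincomb (enum ∘ u) b i)

    independent⇒q^d≤q^n : ∀ {d} {b : Fin d → Vec} → Independent b → q ^ d ℕ.≤ q ^ n
    independent⇒q^d≤q^n {b = b} ind = ≗-injective⇒^≤ (coordinates b) coordinates-injective
      where
      coordinates-injective : ∀ u v → coordinates b u ≗ coordinates b v → u ≗ v
      coordinates-injective u v eq j = enum-injective _ _
        (lincomb-injective ind (enum ∘ u) (enum ∘ v) (λ i →
          trans (sym (enum-index _)) (trans (reflexive (cong enum (eq i))) (enum-index _))) j)

    independent⇒d≤n : ∀ {d} {b : Fin d → Vec} → Independent b → d ℕ.≤ n
    independent⇒d≤n ind = ℕP.≮⇒≥ λ n<d →
      ℕP.<⇒≱ (ℕP.^-monoʳ-< q (HasCard⇒1<q F card) n<d) (independent⇒q^d≤q^n ind)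

  k₁⊓d≤combine-uniform : ∀ λ' .{{_ : ℚ.NonNegative λ'}} {k₁ k₂} → k₁ ℕ.≤ k₂ →
    ∀ V d (h : HasDim V d) → (+ (k₁ ⊓ d)) ℚ./ 1 ℚ.≤ combine λ' (uniform k₁) (uniform k₂) V d h
  k₁⊓d≤combine-uniform λ' {k₁} {k₂} k₁≤k₂ V d h = p≤q⇒p≤[1-λ]p+λq λ'
    (x*v≤u*y⇒x/y≤u/v (k₁ ⊓ d) 1 (k₂ ⊓ d) 1 (ℕP.*-monoˡ-≤ 1 (ℕP.⊓-monoˡ-≤ d k₁≤k₂)))

d≤k*μ⇒d/μ≤k⊓d : ∀ {d} k μ .{{_ : NonZero μ}} → d ℕ.≤ k ℕ.* μ → (+ d) ℚ./ μ ℚ.≤ (+ (k ⊓ d)) ℚ./ 1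
d≤k*μ⇒d/μ≤k⊓d {d} k μ@(suc _) d≤kμ = x*v≤u*y⇒x/y≤u/v d μ (k ⊓ d) 1 (begin
  d ℕ.* 1                   ≡⟨ ℕP.*-identityʳ d ⟩
  d                         ≤⟨ ℕP.⊓-glb d≤kμ (ℕP.m≤m*n d μ) ⟩
  (k ℕ.* μ) ⊓ (d ℕ.* μ)     ≡⟨ ℕP.*-distribʳ-⊓ μ k d ⟨
  (k ⊓ d) ℕ.* μ             ∎)
  where open ℕP.≤-Reasoning

theorem6p1 : ∀ {c ℓ} (F : Field c ℓ) (q : ℕ) → IsFiniteField F q →
    (n k₁ k₂ : ℕ) .{{_ : NonZero k₁}} → 1 ℕ.< k₁ → k₁ ℕ.< k₂ → k₂ ℕ.< n →
    (a μ : ℕ) .{{_ : NonZero μ}} → 1 ℕ.≤ a → 2 ℕ.≤ μ →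
    ℚ.0ℚ ℚ.< (+ a) ℚ./ μ → (+ a) ℚ./ μ ℚ.< ℚ.1ℚ →
    ⌈ n / k₁ ⌉ ℕ.≤ μ →
    let open LinearAlgebra F n in
    ∀ (I : Subspace) →
      IsIndep μ (combine ((+ a) ℚ./ μ) (uniform k₁) (uniform k₂)) I
theorem6p1 F q (_ , card) n k₁ k₂ _ k₁<k₂ _ a μ _ _ _ _ ⌈n/k₁⌉≤μ _ J _ d h@(_ , _ , ind , _) =
  ℚP.≤-trans (d≤k*μ⇒d/μ≤k⊓d k₁ μ d≤k₁μ)
    (k₁⊓d≤combine-uniform F n ((+ a) ℚ./ μ) {{ℚP.normalize-nonNeg a μ}} (ℕP.<⇒≤ k₁<k₂) J d h)
  where
  d≤k₁μ : d ℕ.≤ k₁ ℕ.* μ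
  d≤k₁μ = begin
    d                  ≤⟨ independent⇒d≤n F n card ind ⟩
    n                  ≤⟨ n≤⌈n/k⌉*k n k₁ ⟩
    ⌈ n / k₁ ⌉ ℕ.* k₁  ≤⟨ ℕP.*-monoˡ-≤ k₁ ⌈n/k₁⌉≤μ ⟩
    μ ℕ.* k₁           ≡⟨ ℕP.*-comm μ k₁ ⟩
    k₁ ℕ.* μ           ∎
    where open ℕP.≤-Reasoning
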